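{- Let $a,b$ be integers with $a\neq 0$ and $\gcd(a,b)=1$, let $k$ be a positive integer, let $c_1,e_1\in\mathbb{Q}\setminus\{0\}$ and $c_0,e_0\in\mathbb{Q}$, let $m>4$ be an integer and $\delta\in\mathbb{Q}\setminus\{0\}$. Then, as polynomials in $x$, $$S_{a,b}^k(c_1x+c_0)\neq e_1D_m(x,\delta)+e_0.$$
   Context: For integers $a\neq 0$, $b$ with $\gcd(a,b)=1$ and a positive integer $k$, define the polynomial $$S_{a,b}^k(x):=\frac{a^k}{k+1}\left(B_{k+1}\left(x+\frac{b}{a}\right)-B_{k+1}\left(\frac{b}{a}\right)\right),$$ where $B_n(x)$ is the $n$-th Bernoulli polynomial, defined by $\frac{t e^{tx}}{e^t-1}=\sum_{n\geq 0}B_n(x)\frac{t^n}{n!}$. For a positive integer $m$ and a parameter $\delta$, the $m$-th Dickson polynomial is $$D_m(x,\delta)=\sum_{i=0}^{\lfloor m/2\rfloor}\frac{m}{m-i}\binom{m-i}{i}(-\delta)^i x^{m-2i},$$ equivalently characterized by $D_m(z+\delta/z,\delta)=z^m+(\delta/z)^m$. -}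

module Defs where

open import Data.Nat as ℕ using (ℕ; zero; suc; _∸_; _≤_)
open import Data.Nat.DivMod as ℕ using ()
open import Data.Bool
open import Data.Nat.Combinatorics using (_C_)
open import Data.Integer as ℤ using (ℤ; +_; -[1+_])
open import Data.Rational as ℚ using (ℚ; 0ℚ; 1ℚ; _+_; _*_; -_)
open import Data.List using (List; []; _∷_; replicate; _++_; foldr; upTo; map)
open import Relation.Binary.PropositionalEquality using (_≡_)

ℤ→ℚ : ℤ → ℚ
ℤ→ℚ z = z ℚ./ 1

ℕ→ℚ : ℕ → ℚ
ℕ→ℚ n = ℤ→ℚ (+ n)

-- quotient b / a of integers (only used with a ≠ 0; value at a = 0 is junk 0)
divℤ : ℤ → ℤ → ℚ
divℤ b (+ zero)   = 0ℚ
divℤ b (+ suc n)  = b ℚ./ suc n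
divℤ b -[1+ n ]   = (ℤ.- b) ℚ./ suc n

_^ℚ_ : ℚ → ℕ → ℚ
q ^ℚ zero  = 1ℚ
q ^ℚ suc n = q * (q ^ℚ n)

-- Polynomials over ℚ as coefficient lists [c₀ , c₁ , c₂ , …]
-- (ascending powers of x; trailing zeros allowed)

Poly : Set
Poly = List ℚ

coeff : Poly → ℕ → ℚ
coeff []       n       = 0ℚ
coeff (c ∷ p)  zero    = c
coeff (c ∷ p)  (suc n) = coeff p n

infix 4 _≈ₚ_
_≈ₚ_ : Poly → Poly → Set
p ≈ₚ q = ∀ n → coeff p n ≡ coeff q n

infixl 6 _+ₚ_
_+ₚ_ : Poly → Poly → Poly
[]      +ₚ q       = q
(c ∷ p) +ₚ []      = c ∷ p
(c ∷ p) +ₚ (d ∷ q) = (c + d) ∷ (p +ₚ q)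

infixl 7 _·ₚ_
_·ₚ_ : ℚ → Poly → Poly
c ·ₚ p = map (c *_) p

infixl 7 _*ₚ_
_*ₚ_ : Poly → Poly → Poly
[]      *ₚ q = []
(c ∷ p) *ₚ q = (c ·ₚ q) +ₚ (0ℚ ∷ (p *ₚ q))

constₚ : ℚ → Poly
constₚ c = c ∷ []

Xₚ : Poly
Xₚ = 0ℚ ∷ 1ℚ ∷ []

monoₚ : ℚ → ℕ → Poly
monoₚ c n = replicate n 0ℚ ++ (c ∷ [])

_∘ₚ_ : Poly → Poly → Poly
[]      ∘ₚ q = []
(c ∷ p) ∘ₚ q = constₚ c +ₚ (q *ₚ (p ∘ₚ q))

evalₚ : Poly → ℚ → ℚ
evalₚ []      x = 0ℚ
evalₚ (c ∷ p) x = c + x * evalₚ p x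

sumₚ : ℕ → (ℕ → Poly) → Poly
sumₚ n f = foldr (λ i acc → f i +ₚ acc) [] (upTo (suc n))

sumℚ< : ℕ → (ℕ → ℚ) → ℚ
sumℚ< n f = foldr (λ i acc → f i + acc) 0ℚ (upTo n)

-- Bernoulli numbers B_n (convention B₁ = -1/2, i.e. t/(eᵗ-1) = Σ Bₙ tⁿ/n!)
-- determined by B₀ = 1 and  Σ_{j=0}^{n} C(n+1,j) B_j = 0 for n ≥ 1, i.e.
--   B_n = - 1/(n+1) Σ_{j<n} C(n+1,j) B_j .

nextBern : ℕ → (ℕ → ℚ) → ℚ
nextBern n f = - ((+ 1 ℚ./ suc n) * sumℚ< n (λ j → ℕ→ℚ (suc n C j) * f j))

  -- table n j = B_j for j ≤ n (values for j > n are irrelevant)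
table : ℕ → ℕ → ℚ
table zero    j = 1ℚ
table (suc n) j with j ℕ.≤ᵇ n
... | Data.Bool.true  = table n j
... | Data.Bool.false = nextBern (suc n) (table n)

bernoulliNum : ℕ → ℚ
bernoulliNum n = table n n

bernoulliPoly : ℕ → Poly
bernoulliPoly n = sumₚ n (λ j → monoₚ (ℕ→ℚ (n C j) * bernoulliNum j) (n ∸ j))

S : ℤ → ℤ → ℕ → Poly
S a b k =
  (ℤ→ℚ (a ℤ.^ k) * (+ 1 ℚ./ suc k)) ·ₚ
    ((bernoulliPoly (suc k) ∘ₚ (Xₚ +ₚ constₚ (divℤ b a)))
      +ₚ constₚ (- evalₚ (bernoulliPoly (suc k)) (divℤ b a)))

dickson : ℕ → ℚ → Poly
dickson m δ = sumₚ (m ℕ./ 2) (λ i →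
  monoₚ (divℤ (+ m) (+ (m ∸ i)) * ℕ→ℚ ((m ∸ i) C i) * ((- δ) ^ℚ i)) (m ∸ (2 ℕ.* i)))

module Submission where

-- Write n = k + 1, A = a^k/(k+1) ≠ 0, r = b/a, so S = A(B_n(x + r) - B_n(r)).
-- The binomial formula for composing with an affine polynomial shows that the
-- left side T has degree n and leading coefficient A c₁ⁿ ≠ 0, while
-- e₁D_m + e₀ has degree m and leading coefficient e₁ ≠ 0; this settles n ≠ m.
-- For n = m, the Appell property of Bernoulli polynomials makes the coefficient
-- of x^(n-l) in T equal to A c₁^(n-l) C(n,l) B_l(r + c₀) for l ≤ 4, while the
-- Dickson side has top coefficients e₁, 0, -e₁nδ, 0, e₁ n(n-3)/2 δ².  The
-- x^(n-1) coefficients force B₁(r + c₀) = 0, i.e. r + c₀ = 1/2; then the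
-- coefficients of x^n, x^(n-2), x^(n-4) satisfy a relation that holds on the
-- right but on the left is a nonzero multiple of 9 - 2n, impossible in ℕ.

open import Defs
open import Data.Nat as ℕ using (ℕ; zero; suc; _≤_; _<_; z≤n; s≤s; _∸_)
import Data.Nat.Properties as ℕP
import Data.Nat.DivMod as ℕD
open import Data.Nat.Combinatorics using (_C_; nCk+nC[k+1]≡[n+1]C[k+1]; k>n⇒nCk≡0; nCk≡nC[n∸k]; nC1≡n; _P_; nCk≡nPk/k!; nPk≡n!/[n∸k]!; [n∸k]!k!∣n!; nCn≡1)
open import Data.Nat.Combinatorics.Base using (_P′_)
open import Data.Nat.Divisibility using (_∣_; m*n∣o⇒n∣o/m)
open import Data.Bool as Bool using (true; false)
import Data.Nat.Coprimality as Cop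
open import Data.Integer as ℤ using (ℤ; -[1+_]; 0ℤ; 1ℤ)
import Data.Integer.Properties as ℤP
import Data.Integer.Solver as ℤSolver
open import Data.Integer.GCD using (gcd)
open import Data.Rational as ℚ using (ℚ; mkℚ; 0ℚ; 1ℚ; _+_; _*_; -_; _/_; toℚᵘ)
import Data.Rational.Properties as ℚP
import Data.Rational.Unnormalised as ℚᵘ
import Data.Rational.Unnormalised.Properties as ℚᵘP
open import Data.Rational.Solver using (module +-*-Solver)
open import Data.Product using (_×_)
open import Data.Vec.N-ary using (N-ary)
open import Data.List using (List; []; _∷_; foldr; applyUpTo; upTo; length)
open import Data.Sum using (_⊎_; inj₁; inj₂)
open import Data.Empty using (⊥; ⊥-elim)
open import Function using (_∘_)
open import Relation.Nullary using (¬_; yes; no)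
open import Relation.Binary using (tri<; tri≈; tri>)
open import Relation.Binary.PropositionalEquality

-- The embedding ℤ → ℚ of Defs produces fractions already in lowest terms;
-- this reduces identities about it to identities of unnormalised fractions.

ℤ→ℚ-lowest : ∀ z → ℤ→ℚ z ≡ mkℚ z 0 (Cop.sym (Cop.1-coprimeTo ℤ.∣ z ∣))
ℤ→ℚ-lowest (ℤ.+ n)    = ℚP.normalize-coprime (Cop.sym (Cop.1-coprimeTo n))
ℤ→ℚ-lowest -[1+ n ] = cong -_ (ℚP.normalize-coprime (Cop.sym (Cop.1-coprimeTo (suc n))))

ℤ→ℚ-toℚᵘ : ∀ z → toℚᵘ (ℤ→ℚ z) ≡ ℚᵘ.mkℚᵘ z 0
ℤ→ℚ-toℚᵘ z rewrite ℤ→ℚ-lowest z = refl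

ℤ→ℚ-injective : ∀ {x y} → ℤ→ℚ x ≡ ℤ→ℚ y → x ≡ y
ℤ→ℚ-injective {x} {y} eq =
  trans (cong ℚ.↥_ (sym (ℤ→ℚ-lowest x))) (trans (cong ℚ.↥_ eq) (cong ℚ.↥_ (ℤ→ℚ-lowest y)))

viaℚᵘ : ∀ {p q : ℚ} (u v : ℚᵘ.ℚᵘ) → toℚᵘ p ℚᵘ.≃ u → toℚᵘ q ℚᵘ.≃ v →
        ℚᵘ.↥ u ℤ.* ℚᵘ.↧ v ≡ ℚᵘ.↥ v ℤ.* ℚᵘ.↧ u → p ≡ q
viaℚᵘ u v pu qv eq = ℚP.toℚᵘ-injective (ℚᵘP.≃-trans pu (ℚᵘP.≃-trans (ℚᵘ.*≡* eq) (ℚᵘP.≃-sym qv)))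

ℤ→ℚ-+ : ∀ x y → ℤ→ℚ (x ℤ.+ y) ≡ ℤ→ℚ x + ℤ→ℚ y
ℤ→ℚ-+ x y = viaℚᵘ (ℚᵘ.mkℚᵘ (x ℤ.+ y) 0) (ℚᵘ.mkℚᵘ x 0 ℚᵘ.+ ℚᵘ.mkℚᵘ y 0)
  (ℚᵘP.≃-reflexive (ℤ→ℚ-toℚᵘ (x ℤ.+ y)))
  (ℚᵘP.≃-trans (ℚP.toℚᵘ-homo-+ (ℤ→ℚ x) (ℤ→ℚ y)) (ℚᵘP.≃-reflexive (cong₂ ℚᵘ._+_ (ℤ→ℚ-toℚᵘ x) (ℤ→ℚ-toℚᵘ y))))
  (solve 2 (λ x y → (x :+ y) :* con (ℤ.+ 1) := (x :* con (ℤ.+ 1) :+ y :* con (ℤ.+ 1)) :* con (ℤ.+ 1)) refl x y)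
  where open ℤSolver.+-*-Solver

ℤ→ℚ-* : ∀ x y → ℤ→ℚ (x ℤ.* y) ≡ ℤ→ℚ x * ℤ→ℚ y
ℤ→ℚ-* x y = viaℚᵘ (ℚᵘ.mkℚᵘ (x ℤ.* y) 0) (ℚᵘ.mkℚᵘ x 0 ℚᵘ.* ℚᵘ.mkℚᵘ y 0)
  (ℚᵘP.≃-reflexive (ℤ→ℚ-toℚᵘ (x ℤ.* y)))
  (ℚᵘP.≃-trans (ℚP.toℚᵘ-homo-* (ℤ→ℚ x) (ℤ→ℚ y)) (ℚᵘP.≃-reflexive (cong₂ ℚᵘ._*_ (ℤ→ℚ-toℚᵘ x) (ℤ→ℚ-toℚᵘ y))))
  refl

/-*-cancel : ∀ z d .{{_ : ℕ.NonZero d}} → z / d * ℕ→ℚ d ≡ ℤ→ℚ z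
/-*-cancel z (suc d) = viaℚᵘ (ℚᵘ.mkℚᵘ z d ℚᵘ.* ℚᵘ.mkℚᵘ (ℤ.+ suc d) 0) (ℚᵘ.mkℚᵘ z 0)
  (ℚᵘP.≃-trans (ℚP.toℚᵘ-homo-* (z / suc d) (ℕ→ℚ (suc d)))
     (ℚᵘP.*-cong (ℚP.toℚᵘ-fromℚᵘ (ℚᵘ.mkℚᵘ z d)) (ℚᵘP.≃-reflexive (ℤ→ℚ-toℚᵘ (ℤ.+ suc d)))))
  (ℚᵘP.≃-reflexive (ℤ→ℚ-toℚᵘ z))
  (solve 2 (λ z e → (z :* e) :* con (ℤ.+ 1) := z :* (e :* con (ℤ.+ 1))) refl z (ℤ.+ suc d))
  where open ℤSolver.+-*-Solver

ℕ→ℚ-+ : ∀ x y → ℕ→ℚ (x ℕ.+ y) ≡ ℕ→ℚ x + ℕ→ℚ y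
ℕ→ℚ-+ x y = trans (cong ℤ→ℚ (ℤP.pos-+ x y)) (ℤ→ℚ-+ (ℤ.+ x) (ℤ.+ y))

ℕ→ℚ-* : ∀ x y → ℕ→ℚ (x ℕ.* y) ≡ ℕ→ℚ x * ℕ→ℚ y
ℕ→ℚ-* x y = trans (cong ℤ→ℚ (ℤP.pos-* x y)) (ℤ→ℚ-* (ℤ.+ x) (ℤ.+ y))

ℕ→ℚ-∸ : ∀ {m n} → n ≤ m → ℕ→ℚ (m ∸ n) ≡ ℕ→ℚ m ℚ.- ℕ→ℚ n
ℕ→ℚ-∸ {m} {n} n≤m = begin
    ℕ→ℚ (m ∸ n)                        ≡⟨ solve 2 (λ x y → x := (x :+ y) :- y) refl (ℕ→ℚ (m ∸ n)) (ℕ→ℚ n) ⟩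
    ℕ→ℚ (m ∸ n) + ℕ→ℚ n ℚ.- ℕ→ℚ n     ≡⟨ cong (ℚ._- ℕ→ℚ n) (sym (ℕ→ℚ-+ (m ∸ n) n)) ⟩
    ℕ→ℚ ((m ∸ n) ℕ.+ n) ℚ.- ℕ→ℚ n      ≡⟨ cong (λ x → ℕ→ℚ x ℚ.- ℕ→ℚ n) (ℕP.m∸n+n≡m n≤m) ⟩
    ℕ→ℚ m ℚ.- ℕ→ℚ n                    ∎
  where open ≡-Reasoning
        open +-*-Solver

ℕ→ℚ-injective : ∀ {x y} → ℕ→ℚ x ≡ ℕ→ℚ y → x ≡ y
ℕ→ℚ-injective eq = ℤP.+-injective (ℤ→ℚ-injective eq)

ℕ→ℚ-suc≢0 : ∀ n → ℕ→ℚ (suc n) ≢ 0ℚ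
ℕ→ℚ-suc≢0 n eq with ℕ→ℚ-injective {suc n} {0} eq
... | ()

p*q≡0⇒p≡0∨q≡0 : ∀ p q → p * q ≡ 0ℚ → p ≡ 0ℚ ⊎ q ≡ 0ℚ
p*q≡0⇒p≡0∨q≡0 p q eq with p ℚP.≟ 0ℚ
... | yes p≡0 = inj₁ p≡0
... | no p≢0 = inj₂ (begin
    q                 ≡⟨ sym (ℚP.*-identityˡ q) ⟩
    1ℚ * q            ≡⟨ cong (_* q) (sym (ℚP.*-inverseˡ p)) ⟩
    ℚ.1/ p * p * q    ≡⟨ ℚP.*-assoc (ℚ.1/ p) p q ⟩
    ℚ.1/ p * (p * q)  ≡⟨ cong (ℚ.1/ p *_) eq ⟩
    ℚ.1/ p * 0ℚ       ≡⟨ ℚP.*-zeroʳ (ℚ.1/ p) ⟩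
    0ℚ                ∎)
  where open ≡-Reasoning
        instance _ = ℚ.≢-nonZero p≢0

*-≢0 : ∀ {p q} → p ≢ 0ℚ → q ≢ 0ℚ → p * q ≢ 0ℚ
*-≢0 {p} {q} p≢0 q≢0 eq with p*q≡0⇒p≡0∨q≡0 p q eq
... | inj₁ p≡0 = p≢0 p≡0
... | inj₂ q≡0 = q≢0 q≡0

*-≡0⇒≡0ʳ : ∀ {p q} → p ≢ 0ℚ → p * q ≡ 0ℚ → q ≡ 0ℚ
*-≡0⇒≡0ʳ {p} {q} p≢0 eq with p*q≡0⇒p≡0∨q≡0 p q eq
... | inj₁ p≡0 = ⊥-elim (p≢0 p≡0)
... | inj₂ q≡0 = q≡0

*-cancelʳ : ∀ {p q} r → r ≢ 0ℚ → p * r ≡ q * r → p ≡ q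
*-cancelʳ {p} {q} r r≢0 eq = begin
    p                 ≡⟨ sym (ℚP.*-identityʳ p) ⟩
    p * 1ℚ            ≡⟨ cong (p *_) (sym (ℚP.*-inverseʳ r)) ⟩
    p * (r * ℚ.1/ r)  ≡⟨ sym (ℚP.*-assoc p r _) ⟩
    p * r * ℚ.1/ r    ≡⟨ cong (_* ℚ.1/ r) eq ⟩
    q * r * ℚ.1/ r    ≡⟨ ℚP.*-assoc q r _ ⟩
    q * (r * ℚ.1/ r)  ≡⟨ cong (q *_) (ℚP.*-inverseʳ r) ⟩
    q * 1ℚ            ≡⟨ ℚP.*-identityʳ q ⟩
    q                 ∎
  where open ≡-Reasoning
        instance _ = ℚ.≢-nonZero r≢0

1≢0 : 1ℚ ≢ 0ℚ
1≢0 ()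

^ℚ-≢0 : ∀ {p} n → p ≢ 0ℚ → p ^ℚ n ≢ 0ℚ
^ℚ-≢0 zero    p≢0 ()
^ℚ-≢0 (suc n) p≢0 = *-≢0 p≢0 (^ℚ-≢0 n p≢0)

^ℚ-+ : ∀ x a b → x ^ℚ (a ℕ.+ b) ≡ x ^ℚ a * x ^ℚ b
^ℚ-+ x zero    b = sym (ℚP.*-identityˡ _)
^ℚ-+ x (suc a) b = trans (cong (x *_) (^ℚ-+ x a b)) (sym (ℚP.*-assoc x _ _))

^ℚ-* : ∀ x y n → (x * y) ^ℚ n ≡ x ^ℚ n * y ^ℚ n
^ℚ-* x y zero    = refl
^ℚ-* x y (suc n) = trans (cong ((x * y) *_) (^ℚ-* x y n))
  (solve 4 (λ x y u v → (x :* y) :* (u :* v) := (x :* u) :* (y :* v)) refl x y (x ^ℚ n) (y ^ℚ n))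
  where open +-*-Solver

1^ℚ : ∀ n → 1ℚ ^ℚ n ≡ 1ℚ
1^ℚ zero    = refl
1^ℚ (suc n) = trans (cong (1ℚ *_) (1^ℚ n)) refl

-- Finite sums of rationals.  sumˡ h n = h 0 + (h 1 + …) peels off its first
-- term, matching the recursion of polynomial composition; sumʳ h n =
-- (… + h (n-2)) + h (n-1) peels off its last term, matching splitting a
-- range into an initial and a final segment.

sumˡ : (ℕ → ℚ) → ℕ → ℚ
sumˡ h zero    = 0ℚ
sumˡ h (suc n) = h 0 + sumˡ (h ∘ suc) n

sumʳ : (ℕ → ℚ) → ℕ → ℚ
sumʳ h zero    = 0ℚ
sumʳ h (suc n) = sumʳ h n + h n

sumˡ-cong : ∀ {h g} n → (∀ t → h t ≡ g t) → sumˡ h n ≡ sumˡ g n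
sumˡ-cong zero    e = refl
sumˡ-cong (suc n) e = cong₂ _+_ (e 0) (sumˡ-cong n (e ∘ suc))

sumˡ-scale : ∀ c h n → c * sumˡ h n ≡ sumˡ (λ t → c * h t) n
sumˡ-scale c h zero    = ℚP.*-zeroʳ c
sumˡ-scale c h (suc n) =
  trans (ℚP.*-distribˡ-+ c (h 0) _) (cong (λ z → c * h 0 + z) (sumˡ-scale c (h ∘ suc) n))

sumˡ-+ : ∀ h g n → sumˡ (λ t → h t + g t) n ≡ sumˡ h n + sumˡ g n
sumˡ-+ h g zero    = sym (ℚP.+-identityˡ 0ℚ)
sumˡ-+ h g (suc n) = trans (cong (λ z → h 0 + g 0 + z) (sumˡ-+ (h ∘ suc) (g ∘ suc) n))
                           (solve 4 (λ a b c d → (a :+ b) :+ (c :+ d) := (a :+ c) :+ (b :+ d)) refl (h 0) (g 0) _ _)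
  where open +-*-Solver

sumˡ-zero : ∀ {h} n → (∀ t → t < n → h t ≡ 0ℚ) → sumˡ h n ≡ 0ℚ
sumˡ-zero zero    e = refl
sumˡ-zero (suc n) e = trans (cong₂ _+_ (e 0 (s≤s z≤n)) (sumˡ-zero n (λ t lt → e (suc t) (s≤s lt))))
                            (ℚP.+-identityˡ 0ℚ)

sumˡ-single : ∀ {h} n j → j < n → (∀ t → t < n → t ≢ j → h t ≡ 0ℚ) → sumˡ h n ≡ h j
sumˡ-single {h} (suc n) zero _ e =
  trans (cong (λ z → h 0 + z) (sumˡ-zero n (λ t lt → e (suc t) (s≤s lt) (λ ())))) (ℚP.+-identityʳ _)
sumˡ-single {h} (suc n) (suc j) (s≤s j<n) e =
  trans (cong₂ _+_ (e 0 (s≤s z≤n) (λ ()))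
                   (sumˡ-single n j j<n (λ t lt ne → e (suc t) (s≤s lt) (ne ∘ ℕP.suc-injective))))
        (ℚP.+-identityˡ _)

sumʳ-suc : ∀ h n → sumʳ h (suc n) ≡ h 0 + sumʳ (h ∘ suc) n
sumʳ-suc h zero    = trans (ℚP.+-identityˡ (h 0)) (sym (ℚP.+-identityʳ (h 0)))
sumʳ-suc h (suc n) = trans (cong (_+ h (suc n)) (sumʳ-suc h n)) (ℚP.+-assoc (h 0) _ _)

sumˡ≡sumʳ : ∀ h n → sumˡ h n ≡ sumʳ h n
sumˡ≡sumʳ h zero    = refl
sumˡ≡sumʳ h (suc n) = trans (cong (λ z → h 0 + z) (sumˡ≡sumʳ (h ∘ suc) n)) (sym (sumʳ-suc h n))

sumʳ-cong : ∀ {h g} n → (∀ t → t < n → h t ≡ g t) → sumʳ h n ≡ sumʳ g n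
sumʳ-cong zero    e = refl
sumʳ-cong (suc n) e = cong₂ _+_ (sumʳ-cong n (λ t lt → e t (ℕP.m<n⇒m<1+n lt))) (e n ℕP.≤-refl)

sumʳ-zero : ∀ {h} a → (∀ t → t < a → h t ≡ 0ℚ) → sumʳ h a ≡ 0ℚ
sumʳ-zero zero    e = refl
sumʳ-zero (suc a) e = trans (cong₂ _+_ (sumʳ-zero a (λ t lt → e t (ℕP.m<n⇒m<1+n lt))) (e a ℕP.≤-refl))
                            (ℚP.+-identityˡ 0ℚ)

sumʳ-extend : ∀ {h} M N → (∀ t → M ≤ t → h t ≡ 0ℚ) → M ≤ N → sumʳ h N ≡ sumʳ h M
sumʳ-extend M zero    e z≤n = refl
sumʳ-extend M (suc N) e M≤1+N with ℕP.m≤n⇒m<n∨m≡n M≤1+N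
... | inj₂ refl          = refl
... | inj₁ (s≤s M≤N) = trans (cong₂ _+_ (sumʳ-extend M N e M≤N) (e N M≤N)) (ℚP.+-identityʳ _)

sumʳ-split : ∀ h a b → sumʳ h (b ℕ.+ a) ≡ sumʳ h a + sumʳ (λ j → h (j ℕ.+ a)) b
sumʳ-split h a zero    = sym (ℚP.+-identityʳ _)
sumʳ-split h a (suc b) = trans (cong (_+ h (b ℕ.+ a)) (sumʳ-split h a b)) (ℚP.+-assoc (sumʳ h a) _ _)

coeff-+ : ∀ p q n → coeff (p +ₚ q) n ≡ coeff p n + coeff q n
coeff-+ []      q       n       = sym (ℚP.+-identityˡ _)
coeff-+ (c ∷ p) []      n       = sym (ℚP.+-identityʳ _)
coeff-+ (c ∷ p) (d ∷ q) zero    = refl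
coeff-+ (c ∷ p) (d ∷ q) (suc n) = coeff-+ p q n

coeff-· : ∀ c p n → coeff (c ·ₚ p) n ≡ c * coeff p n
coeff-· c []      n       = sym (ℚP.*-zeroʳ c)
coeff-· c (x ∷ p) zero    = refl
coeff-· c (x ∷ p) (suc n) = coeff-· c p n

coeff-+const : ∀ p c d → 0 < d → coeff (p +ₚ constₚ c) d ≡ coeff p d
coeff-+const p c (suc d) _ = trans (coeff-+ p (constₚ c) (suc d)) (ℚP.+-identityʳ _)

coeff-beyond : ∀ p t → length p ≤ t → coeff p t ≡ 0ℚ
coeff-beyond []      t       _         = refl
coeff-beyond (c ∷ p) (suc t) (s≤s le) = coeff-beyond p t le

coeff-mono : ∀ c t → coeff (monoₚ c t) t ≡ c
coeff-mono c zero    = refl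
coeff-mono c (suc t) = coeff-mono c t

coeff-mono-≢ : ∀ c t d → t ≢ d → coeff (monoₚ c t) d ≡ 0ℚ
coeff-mono-≢ c zero    zero    t≢d = ⊥-elim (t≢d refl)
coeff-mono-≢ c zero    (suc d) _   = refl
coeff-mono-≢ c (suc t) zero    _   = refl
coeff-mono-≢ c (suc t) (suc d) t≢d = coeff-mono-≢ c t d (t≢d ∘ cong suc)

coeff-sumₚ : ∀ N f d → coeff (sumₚ N f) d ≡ sumˡ (λ i → coeff (f i) d) (suc N)
coeff-sumₚ N f d = trans (coeff-foldr (upTo (suc N))) (foldr-applyUpTo (λ i → i) (suc N))
  where
  coeff-foldr : ∀ L → coeff (foldr (λ i acc → f i +ₚ acc) [] L) d ≡ foldr (λ i acc → coeff (f i) d + acc) 0ℚ L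
  coeff-foldr []      = refl
  coeff-foldr (i ∷ L) = trans (coeff-+ (f i) _ d) (cong (λ z → coeff (f i) d + z) (coeff-foldr L))
  foldr-applyUpTo : ∀ g n → foldr (λ i acc → coeff (f i) d + acc) 0ℚ (applyUpTo g n) ≡ sumˡ (λ t → coeff (f (g t)) d) n
  foldr-applyUpTo g zero    = refl
  foldr-applyUpTo g (suc n) = cong (λ z → coeff (f (g 0)) d + z) (foldr-applyUpTo (g ∘ suc) n)

coeff-sumₚ-mono-miss : ∀ N (c : ℕ → ℚ) (e : ℕ → ℕ) d → (∀ i → i < suc N → e i ≢ d) → coeff (sumₚ N (λ i → monoₚ (c i) (e i))) d ≡ 0ℚ
coeff-sumₚ-mono-miss N c e d miss =
  trans (coeff-sumₚ N (λ i → monoₚ (c i) (e i)) d) (sumˡ-zero {λ i → coeff (monoₚ (c i) (e i)) d} (suc N) (λ i lt → coeff-mono-≢ (c i) (e i) d (miss i lt)))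

coeff-sumₚ-mono-hit : ∀ N (c : ℕ → ℚ) (e : ℕ → ℕ) d j → j < suc N → e j ≡ d → (∀ i → i < suc N → e i ≡ d → i ≡ j) →
                      coeff (sumₚ N (λ i → monoₚ (c i) (e i))) d ≡ c j
coeff-sumₚ-mono-hit N c e d j lt hit unique =
  trans (coeff-sumₚ N (λ i → monoₚ (c i) (e i)) d)
    (trans (sumˡ-single {λ i → coeff (monoₚ (c i) (e i)) d} (suc N) j lt (λ i lt' i≢j → coeff-mono-≢ (c i) (e i) d (λ eq → i≢j (unique i lt' eq))))
           (subst (λ z → coeff (monoₚ (c j) z) d ≡ c j) (sym hit) (coeff-mono (c j) d)))

-- By the binomial theorem
-- the coefficient of x^d in p(β + αx) is Σ_t p_t · weight t d, where
-- weight t d = C(t,d) α^d β^(t-d); the weights satisfy Pascal's recursion,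
-- which mirrors the Horner scheme defining _∘ₚ_.

module Affine (β α : ℚ) where

  affine : Poly
  affine = β ∷ α ∷ []

  weight : ℕ → ℕ → ℚ
  weight t d = ℕ→ℚ (t C d) * (α ^ℚ d * β ^ℚ (t ∸ d))

  coeff-affine*-zero : ∀ r → coeff (affine *ₚ r) 0 ≡ β * coeff r 0
  coeff-affine*-zero r = trans (coeff-+ (β ·ₚ r) _ 0) (trans (cong (_+ 0ℚ) (coeff-· β r 0)) (ℚP.+-identityʳ _))

  coeff-affine*-suc : ∀ r e → coeff (affine *ₚ r) (suc e) ≡ β * coeff r (suc e) + α * coeff r e
  coeff-affine*-suc r e = trans (coeff-+ (β ·ₚ r) _ (suc e)) (cong₂ _+_ (coeff-· β r (suc e))
      (trans (coeff-+ (α ·ₚ r) (constₚ 0ℚ) e) (trans (cong₂ _+_ (coeff-· α r e) (coeff-zero e)) (ℚP.+-identityʳ _))))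
    where
    coeff-zero : ∀ e → coeff (constₚ 0ℚ) e ≡ 0ℚ
    coeff-zero zero    = refl
    coeff-zero (suc e) = refl

  weight-vanish : ∀ t d → t < d → weight t d ≡ 0ℚ
  weight-vanish t d t<d = trans (cong (λ c → ℕ→ℚ c * (α ^ℚ d * β ^ℚ (t ∸ d))) (k>n⇒nCk≡0 t<d)) (ℚP.*-zeroˡ (α ^ℚ d * β ^ℚ (t ∸ d)))

  weight-suc-zero : ∀ t → weight (suc t) 0 ≡ β * weight t 0
  weight-suc-zero t = solve 2 (λ b x → con 1ℚ :* (con 1ℚ :* (b :* x)) := b :* (con 1ℚ :* (con 1ℚ :* x))) refl β (β ^ℚ t)
    where open +-*-Solver

  -- Pascal's rule C(t+1,e+1) = C(t,e) + C(t,e+1) moved into ℚ, and the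
  -- ring identity that turns it into the recursion for the weights; the side
  -- condition covers both t ≤ e (then C(t,e+1) = 0) and e < t.
  weight-suc-suc : ∀ t e → weight (suc t) (suc e) ≡ β * weight t (suc e) + α * weight t e
  weight-suc-suc t e = trans (cong (_* ((α * α ^ℚ e) * β ^ℚ (t ∸ e))) pascal)
                             (pascal-step (ℕ→ℚ (t C e)) (ℕ→ℚ (t C suc e)) (α ^ℚ e) _ _ side)
    where
    pascal : ℕ→ℚ (suc t C suc e) ≡ ℕ→ℚ (t C e) + ℕ→ℚ (t C suc e)
    pascal = trans (cong ℕ→ℚ (sym (nCk+nC[k+1]≡[n+1]C[k+1] t e))) (ℕ→ℚ-+ (t C e) (t C suc e))
    pascal-step : ∀ c₁ c₂ x b b′ → c₂ ≡ 0ℚ ⊎ b ≡ β * b′ →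
                  (c₁ + c₂) * ((α * x) * b) ≡ β * (c₂ * ((α * x) * b′)) + α * (c₁ * (x * b))
    pascal-step c₁ .0ℚ x b b′ (inj₁ refl) =
      solve 6 (λ c₁ x b b′ β α → (c₁ :+ con 0ℚ) :* ((α :* x) :* b) := β :* (con 0ℚ :* ((α :* x) :* b′)) :+ α :* (c₁ :* (x :* b)))
        refl c₁ x b b′ β α
      where open +-*-Solver
    pascal-step c₁ c₂ x .(β * b′) b′ (inj₂ refl) =
      solve 6 (λ c₁ c₂ x b′ β α → (c₁ :+ c₂) :* ((α :* x) :* (β :* b′)) := β :* (c₂ :* ((α :* x) :* b′)) :+ α :* (c₁ :* (x :* (β :* b′))))
        refl c₁ c₂ x b′ β α
      where open +-*-Solver
    side : ℕ→ℚ (t C suc e) ≡ 0ℚ ⊎ β ^ℚ (t ∸ e) ≡ β * β ^ℚ (t ∸ suc e)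
    side with t ℕP.≤? e
    ... | yes t≤e = inj₁ (cong ℕ→ℚ (k>n⇒nCk≡0 (s≤s t≤e)))
    ... | no t≰e  = inj₂ (cong (β ^ℚ_) (ℕP.+-∸-assoc 1 (ℕP.≰⇒> t≰e)))

  coeff-∘affine : ∀ p d → coeff (p ∘ₚ affine) d ≡ sumˡ (λ t → coeff p t * weight t d) (length p)
  coeff-∘affine []      d    = refl
  coeff-∘affine (c ∷ p) zero = begin
      coeff (constₚ c +ₚ affine *ₚ (p ∘ₚ affine)) 0       ≡⟨ coeff-+ (constₚ c) (affine *ₚ (p ∘ₚ affine)) 0 ⟩
      c + coeff (affine *ₚ (p ∘ₚ affine)) 0              ≡⟨ cong (c +_) (coeff-affine*-zero (p ∘ₚ affine)) ⟩
      c + β * coeff (p ∘ₚ affine) 0                      ≡⟨ cong (λ z → c + β * z) (coeff-∘affine p 0) ⟩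
      c + β * sumˡ (λ t → coeff p t * weight t 0) (length p)
        ≡⟨ cong₂ _+_ (sym (ℚP.*-identityʳ c)) (sumˡ-scale β _ (length p)) ⟩
      c * 1ℚ + sumˡ (λ t → β * (coeff p t * weight t 0)) (length p)
        ≡⟨ cong (c * 1ℚ +_) (sumˡ-cong (length p) (λ t → trans (swap β (coeff p t) (weight t 0))
                                                               (cong (coeff p t *_) (sym (weight-suc-zero t))))) ⟩
      c * 1ℚ + sumˡ (λ t → coeff p t * weight (suc t) 0) (length p) ∎
    where open ≡-Reasoning
          open +-*-Solver
          swap : ∀ b x y → b * (x * y) ≡ x * (b * y)
          swap = solve 3 (λ b x y → b :* (x :* y) := x :* (b :* y)) refl
  coeff-∘affine (c ∷ p) (suc e) = begin
      coeff (constₚ c +ₚ affine *ₚ (p ∘ₚ affine)) (suc e)  ≡⟨ coeff-+ (constₚ c) (affine *ₚ (p ∘ₚ affine)) (suc e) ⟩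
      0ℚ + coeff (affine *ₚ (p ∘ₚ affine)) (suc e)         ≡⟨ ℚP.+-identityˡ _ ⟩
      coeff (affine *ₚ (p ∘ₚ affine)) (suc e)              ≡⟨ coeff-affine*-suc (p ∘ₚ affine) e ⟩
      β * coeff (p ∘ₚ affine) (suc e) + α * coeff (p ∘ₚ affine) e
        ≡⟨ cong₂ (λ x y → β * x + α * y) (coeff-∘affine p (suc e)) (coeff-∘affine p e) ⟩
      β * sumˡ (λ t → coeff p t * weight t (suc e)) (length p) + α * sumˡ (λ t → coeff p t * weight t e) (length p)
        ≡⟨ cong₂ _+_ (sumˡ-scale β _ (length p)) (sumˡ-scale α _ (length p)) ⟩
      sumˡ (λ t → β * (coeff p t * weight t (suc e))) (length p) + sumˡ (λ t → α * (coeff p t * weight t e)) (length p)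
        ≡⟨ sym (sumˡ-+ _ _ (length p)) ⟩
      sumˡ (λ t → β * (coeff p t * weight t (suc e)) + α * (coeff p t * weight t e)) (length p)
        ≡⟨ sumˡ-cong (length p) (λ t → trans (collect (coeff p t) (weight t (suc e)) (weight t e))
                                             (cong (coeff p t *_) (sym (weight-suc-suc t e)))) ⟩
      sumˡ (λ t → coeff p t * weight (suc t) (suc e)) (length p)
        ≡⟨ sym (ℚP.+-identityˡ _) ⟩
      0ℚ + sumˡ (λ t → coeff p t * weight (suc t) (suc e)) (length p)
        ≡⟨ cong (_+ sumˡ (λ t → coeff p t * weight (suc t) (suc e)) (length p))
                (sym (trans (cong (c *_) (weight-vanish 0 (suc e) (s≤s z≤n))) (ℚP.*-zeroʳ c))) ⟩
      c * weight 0 (suc e) + sumˡ (λ t → coeff p t * weight (suc t) (suc e)) (length p) ∎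
    where open ≡-Reasoning
          open +-*-Solver
          collect : ∀ x y₁ y₂ → β * (x * y₁) + α * (x * y₂) ≡ x * (β * y₁ + α * y₂)
          collect x y₁ y₂ = solve 5 (λ x y₁ y₂ β α → β :* (x :* y₁) :+ α :* (x :* y₂) := x :* (β :* y₁ :+ α :* y₂)) refl x y₁ y₂ β α

  coeff-∘affine-deg : ∀ p D → (∀ t → D < t → coeff p t ≡ 0ℚ) →
                      ∀ d → coeff (p ∘ₚ affine) d ≡ sumʳ (λ t → coeff p t * weight t d) (suc D)
  coeff-∘affine-deg p D deg d = trans (coeff-∘affine p d) (trans (sumˡ≡sumʳ _ (length p)) resize)
    where
    h : ℕ → ℚ
    h t = coeff p t * weight t d
    resize : sumʳ h (length p) ≡ sumʳ h (suc D)
    resize with ℕP.≤-total (length p) (suc D)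
    ... | inj₁ le = sym (sumʳ-extend (length p) (suc D)
                           (λ t le′ → trans (cong (_* weight t d) (coeff-beyond p t le′)) (ℚP.*-zeroˡ (weight t d))) le)
    ... | inj₂ le = sumʳ-extend (suc D) (length p)
                           (λ t le′ → trans (cong (_* weight t d) (deg t le′)) (ℚP.*-zeroˡ (weight t d))) le

  ∘affine-deg : ∀ p D → (∀ t → D < t → coeff p t ≡ 0ℚ) → ∀ d → D < d → coeff (p ∘ₚ affine) d ≡ 0ℚ
  ∘affine-deg p D deg d D<d = trans (coeff-∘affine-deg p D deg d) (sumʳ-zero (suc D) (λ t t≤D →
     trans (cong (coeff p t *_) (weight-vanish t d (ℕP.<-≤-trans t≤D D<d))) (ℚP.*-zeroʳ (coeff p t))))

  coeff-∘affine-top : ∀ p i e → (∀ t → i ℕ.+ e < t → coeff p t ≡ 0ℚ) →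
     coeff (p ∘ₚ affine) e ≡ sumʳ (λ j → coeff p (j ℕ.+ e) * (ℕ→ℚ ((j ℕ.+ e) C j) * (α ^ℚ e * β ^ℚ j))) (suc i)
  coeff-∘affine-top p i e deg = begin
      coeff (p ∘ₚ affine) e                         ≡⟨ coeff-∘affine-deg p (i ℕ.+ e) deg e ⟩
      sumʳ h (suc i ℕ.+ e)                          ≡⟨ sumʳ-split h e (suc i) ⟩
      sumʳ h e + sumʳ (λ j → h (j ℕ.+ e)) (suc i)
        ≡⟨ cong (_+ sumʳ (λ j → h (j ℕ.+ e)) (suc i))
                (sumʳ-zero e (λ t t<e → trans (cong (coeff p t *_) (weight-vanish t e t<e)) (ℚP.*-zeroʳ (coeff p t)))) ⟩
      0ℚ + sumʳ (λ j → h (j ℕ.+ e)) (suc i)        ≡⟨ ℚP.+-identityˡ _ ⟩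
      sumʳ (λ j → h (j ℕ.+ e)) (suc i)              ≡⟨ sumʳ-cong (suc i) (λ j _ → cong (coeff p (j ℕ.+ e) *_) (weight-shift j)) ⟩
      sumʳ (λ j → coeff p (j ℕ.+ e) * (ℕ→ℚ ((j ℕ.+ e) C j) * (α ^ℚ e * β ^ℚ j))) (suc i) ∎
    where
    open ≡-Reasoning
    h : ℕ → ℚ
    h t = coeff p t * weight t e
    weight-shift : ∀ j → weight (j ℕ.+ e) e ≡ ℕ→ℚ ((j ℕ.+ e) C j) * (α ^ℚ e * β ^ℚ j)
    weight-shift j = cong₂ (λ c k → ℕ→ℚ c * (α ^ℚ e * β ^ℚ k))
      (trans (nCk≡nC[n∸k] (ℕP.m≤n+m e j)) (cong ((j ℕ.+ e) C_) (ℕP.m+n∸n≡m j e))) (ℕP.m+n∸n≡m j e)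

  coeff-∘affine-lead : ∀ p D → (∀ t → D < t → coeff p t ≡ 0ℚ) → coeff (p ∘ₚ affine) D ≡ coeff p D * α ^ℚ D
  coeff-∘affine-lead p D deg = trans (coeff-∘affine-top p 0 D deg)
    (solve 2 (λ x y → con 0ℚ :+ x :* (con 1ℚ :* (y :* con 1ℚ)) := x :* y) refl (coeff p D) (α ^ℚ D))
    where open +-*-Solver

-- Binomial coefficients are falling factorials over factorials,
-- C(n,k) = n(n-1)⋯(n-k+1)/k!, so each C(j+x, j) is a polynomial in x.

falling : ℚ → ℕ → ℚ
falling N zero    = 1ℚ
falling N (suc k) = (N ℚ.- ℕ→ℚ k) * falling N k

binomℚ : ℕ → ℚ → ℚ
binomℚ k N = (ℤ.+ 1 / k ℕ.!) {{k ℕP.!≢0}} * falling N k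

ℕ→ℚ-P′ : ∀ {n} k → k ≤ n → ℕ→ℚ (n P′ k) ≡ falling (ℕ→ℚ n) k
ℕ→ℚ-P′ zero    _   = refl
ℕ→ℚ-P′ {n} (suc k) k<n = trans (ℕ→ℚ-* (n ∸ k) (n P′ k))
  (cong₂ _*_ (ℕ→ℚ-∸ (ℕP.<⇒≤ k<n)) (ℕ→ℚ-P′ k (ℕP.<⇒≤ k<n)))

nPk≡nP′k : ∀ {n k} → k ≤ n → n P k ≡ n P′ k
nPk≡nP′k {n} {k} k≤n with k ℕ.≤ᵇ n in eq
... | true  = refl
... | false = ⊥-elim (subst Bool.T eq (ℕP.≤⇒≤ᵇ k≤n))

k!∣nPk : ∀ {n k} → k ≤ n → k ℕ.! ∣ n P k
k!∣nPk {n} {k} k≤n = subst (k ℕ.! ∣_) (sym (nPk≡n!/[n∸k]! k≤n))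
  (m*n∣o⇒n∣o/m ((n ∸ k) ℕ.!) (k ℕ.!) {{(n ∸ k) ℕP.!≢0}} ([n∸k]!k!∣n! k≤n))

k!*nCk≡nP′k : ∀ {n} k → k ≤ n → k ℕ.! ℕ.* (n C k) ≡ n P′ k
k!*nCk≡nP′k {n} k k≤n = begin
    k ℕ.! ℕ.* (n C k)              ≡⟨ cong (k ℕ.! ℕ.*_) (nCk≡nPk/k! k≤n) ⟩
    k ℕ.! ℕ.* ((n P k) ℕ./ k ℕ.!)  ≡⟨ ℕD.m*[n/m]≡n (k!∣nPk k≤n) ⟩
    n P k                          ≡⟨ nPk≡nP′k k≤n ⟩
    n P′ k                         ∎
  where open ≡-Reasoning
        instance _ = k ℕP.!≢0

binomial-closed : ∀ {n} k → k ≤ n → ℕ→ℚ (n C k) ≡ binomℚ k (ℕ→ℚ n)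
binomial-closed {n} k k≤n = begin
    ℕ→ℚ (n C k)                        ≡⟨ sym (ℚP.*-identityˡ _) ⟩
    1ℚ * ℕ→ℚ (n C k)                   ≡⟨ cong (_* ℕ→ℚ (n C k)) (sym (/-*-cancel (ℤ.+ 1) (k ℕ.!))) ⟩
    u * ℕ→ℚ (k ℕ.!) * ℕ→ℚ (n C k)      ≡⟨ ℚP.*-assoc u _ _ ⟩
    u * (ℕ→ℚ (k ℕ.!) * ℕ→ℚ (n C k))    ≡⟨ cong (u *_) (sym (ℕ→ℚ-* (k ℕ.!) (n C k))) ⟩
    u * ℕ→ℚ (k ℕ.! ℕ.* (n C k))        ≡⟨ cong (λ x → u * ℕ→ℚ x) (k!*nCk≡nP′k k k≤n) ⟩
    u * ℕ→ℚ (n P′ k)                   ≡⟨ cong (u *_) (ℕ→ℚ-P′ k k≤n) ⟩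
    binomℚ k (ℕ→ℚ n)                   ∎
  where open ≡-Reasoning
        instance _ = k ℕP.!≢0
        u : ℚ
        u = ℤ.+ 1 / k ℕ.!

bernoulliPoly-coeff : ∀ i d → coeff (bernoulliPoly (i ℕ.+ d)) d ≡ ℕ→ℚ ((i ℕ.+ d) C i) * bernoulliNum i
bernoulliPoly-coeff i d = coeff-sumₚ-mono-hit n (λ j → ℕ→ℚ (n C j) * bernoulliNum j) (n ∸_) d i
    (s≤s (ℕP.m≤m+n i d)) (ℕP.m+n∸m≡n i d) unique
  where
  n : ℕ
  n = i ℕ.+ d
  unique : ∀ t → t < suc n → n ∸ t ≡ d → t ≡ i
  unique t (s≤s t≤n) eq = ℕP.+-cancelˡ-≡ d t i (begin
      d ℕ.+ t          ≡⟨ cong (ℕ._+ t) (sym eq) ⟩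
      (n ∸ t) ℕ.+ t    ≡⟨ ℕP.m∸n+n≡m t≤n ⟩
      i ℕ.+ d          ≡⟨ ℕP.+-comm i d ⟩
      d ℕ.+ i          ∎)
    where open ≡-Reasoning

bernoulliPoly-deg : ∀ n d → n < d → coeff (bernoulliPoly n) d ≡ 0ℚ
bernoulliPoly-deg n d n<d = coeff-sumₚ-mono-miss n (λ j → ℕ→ℚ (n C j) * bernoulliNum j) (n ∸_) d
  (λ t _ eq → ℕP.<-irrefl eq (ℕP.≤-<-trans (ℕP.m∸n≤m n t) n<d))

bernoulliAt : ℕ → ℚ → ℚ
bernoulliAt l x = sumʳ (λ j → ℕ→ℚ (l C j) * bernoulliNum j * x ^ℚ (l ∸ j)) (suc l)

½ : ℚ
½ = ℤ.+ 1 / 2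

bernoulliAt-0 : ∀ l → bernoulliAt l 0ℚ ≡ bernoulliNum l
bernoulliAt-0 l = begin
    bernoulliAt l 0ℚ                                 ≡⟨ cong₂ _+_ (sumʳ-zero l lower) refl ⟩
    0ℚ + ℕ→ℚ (l C l) * bernoulliNum l * 0ℚ ^ℚ (l ∸ l) ≡⟨ cong₂ (λ a b → 0ℚ + ℕ→ℚ a * bernoulliNum l * 0ℚ ^ℚ b) (nCn≡1 l) (ℕP.n∸n≡0 l) ⟩
    0ℚ + 1ℚ * bernoulliNum l * 1ℚ                    ≡⟨ solve 1 (λ b → con 0ℚ :+ con 1ℚ :* b :* con 1ℚ := b) refl (bernoulliNum l) ⟩
    bernoulliNum l                                   ∎
  where
  open ≡-Reasoning
  open +-*-Solver
  lower : ∀ j → j < l → ℕ→ℚ (l C j) * bernoulliNum j * 0ℚ ^ℚ (l ∸ j) ≡ 0ℚ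
  lower j j<l = trans (cong (λ e → ℕ→ℚ (l C j) * bernoulliNum j * 0ℚ ^ℚ e) (ℕP.+-∸-assoc 1 j<l))
                      (trans (cong (ℕ→ℚ (l C j) * bernoulliNum j *_) (ℚP.*-zeroˡ (0ℚ ^ℚ (l ∸ suc j)))) (ℚP.*-zeroʳ (ℕ→ℚ (l C j) * bernoulliNum j)))

κ : ℕ → ℚ → ℕ → ℚ
κ m δ i = divℤ (ℤ.+ m) (ℤ.+ (m ∸ i)) * ℕ→ℚ ((m ∸ i) C i) * ((- δ) ^ℚ i)

κ-0 : ∀ m δ → κ (suc m) δ 0 ≡ 1ℚ
κ-0 m δ = trans (solve 1 (λ d → d :* con 1ℚ :* con 1ℚ := d) refl d) d≡1
  where
  open +-*-Solver
  d : ℚ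
  d = divℤ (ℤ.+ suc m) (ℤ.+ suc m)
  d≡1 : d ≡ 1ℚ
  d≡1 = *-cancelʳ (ℕ→ℚ (suc m)) (ℕ→ℚ-suc≢0 m) (trans (/-*-cancel (ℤ.+ suc m) (suc m)) (sym (ℚP.*-identityˡ _)))

dickson-index : ∀ l d i → 0 < d → (l ℕ.+ d) ∸ 2 ℕ.* i ≡ d → 2 ℕ.* i ≡ l
dickson-index l d i 0<d eq = ℕP.∸-cancelˡ-≡ 2i≤m (ℕP.m≤m+n l d) (trans eq (sym (ℕP.m+n∸m≡n l d)))
  where
  2i≤m : 2 ℕ.* i ≤ l ℕ.+ d
  2i≤m with 2 ℕ.* i ℕP.≤? l ℕ.+ d
  ... | yes le = le
  ... | no  gt = ⊥-elim (ℕP.<-irrefl (trans (sym (ℕP.m≤n⇒m∸n≡0 (ℕP.<⇒≤ (ℕP.≰⇒> gt)))) eq) 0<d)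

dickson-coeff : ∀ m δ l d i → 0 < d → l ℕ.+ d ≡ m → 2 ℕ.* i ≡ l → coeff (dickson m δ) d ≡ κ m δ i
dickson-coeff m δ l d i 0<d refl 2i≡l = coeff-sumₚ-mono-hit (m ℕ./ 2) (κ m δ) (λ i → m ∸ 2 ℕ.* i) d i
    i≤m/2 (trans (cong (m ∸_) 2i≡l) (ℕP.m+n∸m≡n l d))
    (λ j _ eq → ℕP.*-cancelˡ-≡ j i 2 (trans (dickson-index l d j 0<d eq) (sym 2i≡l)))
  where
  i≤m/2 : i < suc (m ℕ./ 2)
  i≤m/2 = s≤s (subst (ℕ._≤ m ℕ./ 2) (ℕD.m*n/n≡m i 2) (ℕD./-monoˡ-≤ 2
            (subst (ℕ._≤ m) (trans (sym 2i≡l) (ℕP.*-comm 2 i)) (ℕP.m≤m+n l d))))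

dickson-gap : ∀ m δ l d → 0 < d → l ℕ.+ d ≡ m → (∀ i → 2 ℕ.* i ≢ l) → coeff (dickson m δ) d ≡ 0ℚ
dickson-gap m δ l d 0<d refl odd = coeff-sumₚ-mono-miss (m ℕ./ 2) (κ m δ) (λ i → m ∸ 2 ℕ.* i) d
  (λ i _ eq → odd i (dickson-index l d i 0<d eq))

dickson-deg : ∀ m δ d → m < d → coeff (dickson m δ) d ≡ 0ℚ
dickson-deg m δ d m<d = coeff-sumₚ-mono-miss (m ℕ./ 2) (κ m δ) (λ i → m ∸ 2 ℕ.* i) d
  (λ i _ eq → ℕP.<-irrefl eq (ℕP.≤-<-trans (ℕP.m∸n≤m m (2 ℕ.* i)) m<d))

-- Syntactic counterparts, for the ring solver, of powers, sums, binomial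
-- coefficients and Bernoulli values.  When the natural-number arguments are
-- numerals their denotations reduce to the functions defined above.
module Syntax {v : ℕ} where
  open +-*-Solver

  powS : Polynomial v → ℕ → Polynomial v
  powS x zero    = con 1ℚ
  powS x (suc k) = x :* powS x k

  -- x^k · y, used for powers x^(k+E) with x^E kept as an atom y
  powAtomS : Polynomial v → ℕ → Polynomial v → Polynomial v
  powAtomS x zero    y = y
  powAtomS x (suc k) y = x :* powAtomS x k y

  sumʳS : (ℕ → Polynomial v) → ℕ → Polynomial v
  sumʳS h zero    = con 0ℚ
  sumʳS h (suc k) = sumʳS h k :+ h k

  fallingS : Polynomial v → ℕ → Polynomial v
  fallingS N zero    = con 1ℚ
  fallingS N (suc k) = (N :- con (ℕ→ℚ k)) :* fallingS N k

  binomS : ℕ → Polynomial v → Polynomial v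
  binomS k N = con ((ℤ.+ 1 / k ℕ.!) {{k ℕP.!≢0}}) :* fallingS N k

  bernoulliS : ℕ → Polynomial v → Polynomial v
  bernoulliS l x = sumʳS (λ j → con (ℕ→ℚ (l C j) * bernoulliNum j) :* powS x (l ∸ j)) (suc l)

-- Fix E and write n = 4 + E.  A polynomial p has Bernoulli top (K, γ, s)
-- if deg p ≤ n and, for l ≤ 4, its coefficient of x^(n-l) is
-- K γ^(n-l) C(n,l) B_l(s).  By the Appell property
-- B_l(x + y) = Σ_j C(l,j) B_(l-j)(x) y^j this shape survives composition
-- with β + αx, which sends (K, γ, s) to (K, αγ, s + γβ).

module BernoulliTop (E : ℕ) where
  ν : ℚ
  ν = ℕ→ℚ E

  N : ℚ
  N = ℕ→ℚ 4 + ν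

  record HasBernoulliTop (p : Poly) (K γ s : ℚ) : Set where
    field
      degree : ∀ t → 4 ℕ.+ E < t → coeff p t ≡ 0ℚ
      top    : ∀ l c → l ℕ.+ c ≡ 4 → coeff p (c ℕ.+ E) ≡ K * γ ^ℚ (c ℕ.+ E) * binomℚ l N * bernoulliAt l s

  split-n : ∀ l c → l ℕ.+ c ≡ 4 → l ℕ.+ (c ℕ.+ E) ≡ 4 ℕ.+ E
  split-n l c eq = trans (sym (ℕP.+-assoc l c E)) (cong (ℕ._+ E) eq)

  bernoulliPoly-top : HasBernoulliTop (bernoulliPoly (4 ℕ.+ E)) 1ℚ 1ℚ 0ℚ
  bernoulliPoly-top = record { degree = bernoulliPoly-deg (4 ℕ.+ E) ; top = top }
    where
    top : ∀ l c → l ℕ.+ c ≡ 4 → coeff (bernoulliPoly (4 ℕ.+ E)) (c ℕ.+ E) ≡ 1ℚ * 1ℚ ^ℚ (c ℕ.+ E) * binomℚ l N * bernoulliAt l 0ℚ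
    top l c eq = begin
        coeff (bernoulliPoly (4 ℕ.+ E)) (c ℕ.+ E)            ≡⟨ cong (λ n → coeff (bernoulliPoly n) (c ℕ.+ E)) (sym (split-n l c eq)) ⟩
        coeff (bernoulliPoly (l ℕ.+ (c ℕ.+ E))) (c ℕ.+ E)    ≡⟨ bernoulliPoly-coeff l (c ℕ.+ E) ⟩
        ℕ→ℚ ((l ℕ.+ (c ℕ.+ E)) C l) * bernoulliNum l         ≡⟨ cong₂ _*_ binomial (sym (bernoulliAt-0 l)) ⟩
        binomℚ l N * bernoulliAt l 0ℚ                        ≡⟨ solve 2 (λ x y → x :* y := con 1ℚ :* con 1ℚ :* x :* y) refl (binomℚ l N) (bernoulliAt l 0ℚ) ⟩
        1ℚ * 1ℚ * binomℚ l N * bernoulliAt l 0ℚ              ≡⟨ cong (λ z → 1ℚ * z * binomℚ l N * bernoulliAt l 0ℚ) (sym (1^ℚ (c ℕ.+ E))) ⟩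
        1ℚ * 1ℚ ^ℚ (c ℕ.+ E) * binomℚ l N * bernoulliAt l 0ℚ ∎
      where
      open ≡-Reasoning
      open +-*-Solver
      binomial : ℕ→ℚ ((l ℕ.+ (c ℕ.+ E)) C l) ≡ binomℚ l N
      binomial = trans (binomial-closed l (ℕP.m≤m+n l (c ℕ.+ E)))
                       (cong (binomℚ l) (trans (cong ℕ→ℚ (split-n l c eq)) (ℕ→ℚ-+ 4 E)))

  -- Scaling and adding a constant (which only affects x⁰, below x^(n-4)).
  scale-shift : ∀ {p K γ s} A e → 0 < E → HasBernoulliTop p K γ s →
                HasBernoulliTop (A ·ₚ (p +ₚ constₚ e)) (A * K) γ s
  scale-shift {p} {K} {γ} {s} A e 0<E shape = record { degree = degree′ ; top = top′ }
    where
    open HasBernoulliTop shape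
    coeff-scale-shift : ∀ t → 0 < t → coeff (A ·ₚ (p +ₚ constₚ e)) t ≡ A * coeff p t
    coeff-scale-shift t 0<t = trans (coeff-· A (p +ₚ constₚ e) t) (cong (A *_) (coeff-+const p e t 0<t))
    degree′ : ∀ t → 4 ℕ.+ E < t → coeff (A ·ₚ (p +ₚ constₚ e)) t ≡ 0ℚ
    degree′ t lt = trans (coeff-scale-shift t (ℕP.<-trans (s≤s z≤n) lt)) (trans (cong (A *_) (degree t lt)) (ℚP.*-zeroʳ A))
    top′ : ∀ l c → l ℕ.+ c ≡ 4 → coeff (A ·ₚ (p +ₚ constₚ e)) (c ℕ.+ E) ≡ A * K * γ ^ℚ (c ℕ.+ E) * binomℚ l N * bernoulliAt l s
    top′ l c eq = trans (coeff-scale-shift (c ℕ.+ E) (ℕP.<-≤-trans 0<E (ℕP.m≤n+m E c)))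
      (trans (cong (A *_) (top l c eq))
             (solve 5 (λ A K g b B → A :* (K :* g :* b :* B) := A :* K :* g :* b :* B) refl A K (γ ^ℚ (c ℕ.+ E)) (binomℚ l N) (bernoulliAt l s)))
      where open +-*-Solver

  -- The Appell identity for l + c = 4 as an equation for the ring solver, in
  -- the variables K, γ, Γ = γ^E, α, Α = α^E, s, β, ν: the Taylor sum of the
  -- composed coefficient of x^(c+E) equals the new top coefficient.
  module _ where
    open +-*-Solver
    open Syntax

    appell-equation : ℕ → ℕ → N-ary 8 (Polynomial 8) (Polynomial 8 × Polynomial 8)
    appell-equation l c K γ Γ α Α s β ν =
      sumʳS (λ j → (K :* powAtomS γ (j ℕ.+ c) Γ :* binomS (l ∸ j) (con (ℕ→ℚ 4) :+ ν) :* bernoulliS (l ∸ j) s)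
                   :* (binomS j (con (ℕ→ℚ (j ℕ.+ c)) :+ ν) :* (powAtomS α c Α :* powS β j))) (suc l)
      := K :* (powS (α :* γ) c :* (Α :* Γ)) :* binomS l (con (ℕ→ℚ 4) :+ ν) :* bernoulliS l (s :+ γ :* β)

  compose : ∀ {p K γ s} β α → HasBernoulliTop p K γ s →
            HasBernoulliTop (p ∘ₚ Affine.affine β α) K (α * γ) (s + γ * β)
  compose {p} {K} {γ} {s} β α shape = record { degree = ∘affine-deg p (4 ℕ.+ E) degree ; top = top′ }
    where
    open HasBernoulliTop shape
    open Affine β α
    open +-*-Solver using (solve)

    term : ℕ → ℕ → ℕ → ℚ
    term l c j = (K * γ ^ℚ ((j ℕ.+ c) ℕ.+ E) * binomℚ (l ∸ j) N * bernoulliAt (l ∸ j) s)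
                 * (binomℚ j (ℕ→ℚ (j ℕ.+ c) + ν) * (α ^ℚ (c ℕ.+ E) * β ^ℚ j))

    term-eq : ∀ l c → l ℕ.+ c ≡ 4 → ∀ j → j < suc l →
              coeff p (j ℕ.+ (c ℕ.+ E)) * (ℕ→ℚ ((j ℕ.+ (c ℕ.+ E)) C j) * (α ^ℚ (c ℕ.+ E) * β ^ℚ j)) ≡ term l c j
    term-eq l c eq j (s≤s j≤l) = cong₂ (λ x y → x * (y * (α ^ℚ (c ℕ.+ E) * β ^ℚ j))) coefficient binomial
      where
      reassoc : j ℕ.+ (c ℕ.+ E) ≡ (j ℕ.+ c) ℕ.+ E
      reassoc = sym (ℕP.+-assoc j c E)
      rest : (l ∸ j) ℕ.+ (j ℕ.+ c) ≡ 4
      rest = trans (sym (ℕP.+-assoc (l ∸ j) j c)) (trans (cong (ℕ._+ c) (ℕP.m∸n+n≡m j≤l)) eq)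
      coefficient : coeff p (j ℕ.+ (c ℕ.+ E)) ≡ K * γ ^ℚ ((j ℕ.+ c) ℕ.+ E) * binomℚ (l ∸ j) N * bernoulliAt (l ∸ j) s
      coefficient = trans (cong (coeff p) reassoc) (top (l ∸ j) (j ℕ.+ c) rest)
      binomial : ℕ→ℚ ((j ℕ.+ (c ℕ.+ E)) C j) ≡ binomℚ j (ℕ→ℚ (j ℕ.+ c) + ν)
      binomial = trans (binomial-closed j (ℕP.m≤m+n j (c ℕ.+ E)))
                       (cong (binomℚ j) (trans (cong ℕ→ℚ reassoc) (ℕ→ℚ-+ (j ℕ.+ c) E)))

    appell : ∀ l c → l ℕ.+ c ≡ 4 →
             sumʳ (term l c) (suc l) ≡ K * ((α * γ) ^ℚ c * (α ^ℚ E * γ ^ℚ E)) * binomℚ l N * bernoulliAt l (s + γ * β)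
    appell 0 .4 refl = solve 8 (appell-equation 0 4) refl K γ (γ ^ℚ E) α (α ^ℚ E) s β ν
    appell 1 .3 refl = solve 8 (appell-equation 1 3) refl K γ (γ ^ℚ E) α (α ^ℚ E) s β ν
    appell 2 .2 refl = solve 8 (appell-equation 2 2) refl K γ (γ ^ℚ E) α (α ^ℚ E) s β ν
    appell 3 .1 refl = solve 8 (appell-equation 3 1) refl K γ (γ ^ℚ E) α (α ^ℚ E) s β ν
    appell 4 .0 refl = solve 8 (appell-equation 4 0) refl K γ (γ ^ℚ E) α (α ^ℚ E) s β ν

    top′ : ∀ l c → l ℕ.+ c ≡ 4 →
           coeff (p ∘ₚ affine) (c ℕ.+ E) ≡ K * (α * γ) ^ℚ (c ℕ.+ E) * binomℚ l N * bernoulliAt l (s + γ * β)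
    top′ l c eq = begin
        coeff (p ∘ₚ affine) (c ℕ.+ E)
          ≡⟨ coeff-∘affine-top p l (c ℕ.+ E) (λ t lt → degree t (subst (ℕ._< t) (split-n l c eq) lt)) ⟩
        sumʳ (λ j → coeff p (j ℕ.+ (c ℕ.+ E)) * (ℕ→ℚ ((j ℕ.+ (c ℕ.+ E)) C j) * (α ^ℚ (c ℕ.+ E) * β ^ℚ j))) (suc l)
          ≡⟨ sumʳ-cong (suc l) (term-eq l c eq) ⟩
        sumʳ (term l c) (suc l)
          ≡⟨ appell l c eq ⟩
        K * ((α * γ) ^ℚ c * (α ^ℚ E * γ ^ℚ E)) * binomℚ l N * bernoulliAt l (s + γ * β)
          ≡⟨ cong (λ z → K * z * binomℚ l N * bernoulliAt l (s + γ * β)) powers ⟩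
        K * (α * γ) ^ℚ (c ℕ.+ E) * binomℚ l N * bernoulliAt l (s + γ * β) ∎
      where
      open ≡-Reasoning
      powers : (α * γ) ^ℚ c * (α ^ℚ E * γ ^ℚ E) ≡ (α * γ) ^ℚ (c ℕ.+ E)
      powers = trans (cong ((α * γ) ^ℚ c *_) (sym (^ℚ-* α γ E))) (sym (^ℚ-+ (α * γ) c E))

module DicksonTop (E : ℕ) (δ : ℚ) where
  open BernoulliTop E using (ν; N)

  m : ℕ
  m = 4 ℕ.+ E

  κ-1 : κ m δ 1 ≡ N * (- δ * 1ℚ)
  κ-1 = begin
      d * ℕ→ℚ ((3 ℕ.+ E) C 1) * (- δ * 1ℚ) ≡⟨ cong (λ z → d * ℕ→ℚ z * (- δ * 1ℚ)) (nC1≡n (3 ℕ.+ E)) ⟩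
      d * ℕ→ℚ (3 ℕ.+ E) * (- δ * 1ℚ)       ≡⟨ cong (_* (- δ * 1ℚ)) (trans (/-*-cancel (ℤ.+ m) (3 ℕ.+ E)) (ℕ→ℚ-+ 4 E)) ⟩
      N * (- δ * 1ℚ)                       ∎
    where open ≡-Reasoning
          d : ℚ
          d = divℤ (ℤ.+ m) (ℤ.+ (3 ℕ.+ E))

  κ-2 : κ m δ 2 ≡ ½ * (N * (ℕ→ℚ 1 + ν)) * (- δ * (- δ * 1ℚ))
  κ-2 = begin
      d * ℕ→ℚ ((2 ℕ.+ E) C 2) * D            ≡⟨ cong (λ z → d * z * D) (trans (binomial-closed 2 (ℕP.m≤m+n 2 E)) (cong (binomℚ 2) (ℕ→ℚ-+ 2 E))) ⟩
      d * binomℚ 2 (ℕ→ℚ 2 + ν) * D           ≡⟨ solve 3 (λ d ν D → d :* binomS 2 (con (ℕ→ℚ 2) :+ ν) :* D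
                                                       := con ½ :* ((d :* (con (ℕ→ℚ 2) :+ ν)) :* (con (ℕ→ℚ 1) :+ ν)) :* D) refl d ν D ⟩
      ½ * ((d * (ℕ→ℚ 2 + ν)) * (ℕ→ℚ 1 + ν)) * D ≡⟨ cong (λ z → ½ * (z * (ℕ→ℚ 1 + ν)) * D) dX≡N ⟩
      ½ * (N * (ℕ→ℚ 1 + ν)) * D   ∎
    where open ≡-Reasoning
          open +-*-Solver
          open Syntax
          d D : ℚ
          d = divℤ (ℤ.+ m) (ℤ.+ (2 ℕ.+ E))
          D = - δ * (- δ * 1ℚ)
          dX≡N : d * (ℕ→ℚ 2 + ν) ≡ N
          dX≡N = trans (cong (d *_) (sym (ℕ→ℚ-+ 2 E))) (trans (/-*-cancel (ℤ.+ m) (2 ℕ.+ E)) (ℕ→ℚ-+ 4 E))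

coeff-rhs : ∀ e₁ e₀ D d → 0 < d → coeff (e₁ ·ₚ D +ₚ constₚ e₀) d ≡ e₁ * coeff D d
coeff-rhs e₁ e₀ D d 0<d = trans (coeff-+const (e₁ ·ₚ D) e₀ d 0<d) (coeff-· e₁ D d)

-- Comparing the coefficients of x^(n-1) gives B₁(s) = 0,
-- i.e. s = 1/2.  On the right the coefficients x₀, x₂, x₄ of x^n, x^(n-2),
-- x^(n-4) satisfy x₂²(n-3) = 2n x₄ x₀; on the left, with B₂(1/2) = -1/12
-- and B₄(1/2) = 7/240, the same expression is a nonzero multiple of
-- 9 - 2n = 1 - 2ν, which is odd.

module EqualDegree (p : ℕ) where
  E : ℕ
  E = suc p
  open BernoulliTop E

  dicksonRelation : ℚ → ℚ → ℚ → ℚ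
  dicksonRelation x₂ x₄ x₀ = x₂ * x₂ * (ℕ→ℚ 1 + ν) ℚ.- ℕ→ℚ 2 * N * x₄ * x₀

  shifted≢0 : ∀ j → ℕ→ℚ (suc j) + ν ≢ 0ℚ
  shifted≢0 j eq = ℕ→ℚ-suc≢0 (j ℕ.+ E) (trans (ℕ→ℚ-+ (suc j) E) eq)

  1-2ν≢0 : 1ℚ ℚ.- ℕ→ℚ 2 * ν ≢ 0ℚ
  1-2ν≢0 eq = ℕP.even≢odd E 0 (ℕ→ℚ-injective (begin
      ℕ→ℚ (2 ℕ.* E)                        ≡⟨ ℕ→ℚ-* 2 E ⟩
      ℕ→ℚ 2 * ν                            ≡⟨ solve 1 (λ x → x := con 1ℚ :- (con 1ℚ :- x)) refl (ℕ→ℚ 2 * ν) ⟩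
      1ℚ ℚ.- (1ℚ ℚ.- ℕ→ℚ 2 * ν)            ≡⟨ cong (λ z → 1ℚ ℚ.- z) eq ⟩
      1ℚ ℚ.- 0ℚ                            ≡⟨⟩
      ℕ→ℚ 1                                ∎))
    where open ≡-Reasoning
          open +-*-Solver

  module _ {T : Poly} {K γ s : ℚ} (K≢0 : K ≢ 0ℚ) (γ≢0 : γ ≢ 0ℚ) (shape : HasBernoulliTop T K γ s)
           {e₁ e₀ δ : ℚ} (e₁≢0 : e₁ ≢ 0ℚ) (T≈R : T ≈ₚ e₁ ·ₚ dickson (4 ℕ.+ E) δ +ₚ constₚ e₀) where
    open HasBernoulliTop shape
    open DicksonTop E δ using (m; κ-1; κ-2)
    open +-*-Solver
    open Syntax

    pos : ∀ c → 0 < c ℕ.+ E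
    pos c = ℕP.<-≤-trans (s≤s z≤n) (ℕP.m≤n+m E c)

    compare : ∀ l c → l ℕ.+ c ≡ 4 → ∀ v → coeff (dickson m δ) (c ℕ.+ E) ≡ v →
              K * γ ^ℚ (c ℕ.+ E) * binomℚ l N * bernoulliAt l s ≡ e₁ * v
    compare l c eq v dv = begin
        K * γ ^ℚ (c ℕ.+ E) * binomℚ l N * bernoulliAt l s ≡⟨ sym (top l c eq) ⟩
        coeff T (c ℕ.+ E)                                 ≡⟨ T≈R (c ℕ.+ E) ⟩
        coeff (e₁ ·ₚ dickson m δ +ₚ constₚ e₀) (c ℕ.+ E)  ≡⟨ coeff-rhs e₁ e₀ (dickson m δ) (c ℕ.+ E) (pos c) ⟩
        e₁ * coeff (dickson m δ) (c ℕ.+ E)                ≡⟨ cong (e₁ *_) dv ⟩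
        e₁ * v                                            ∎
      where open ≡-Reasoning

    -- the x^(n-1) coefficients force B₁(s) = s - 1/2 to vanish
    s≡½ : s ≡ ½
    s≡½ = begin
        s                        ≡⟨ solve 1 (λ s → s := bernoulliS 1 s :+ con ½) refl s ⟩
        bernoulliAt 1 s + ½      ≡⟨ cong (_+ ½) (*-≡0⇒≡0ʳ scale≢0 (trans (compare 1 3 refl 0ℚ gap) (ℚP.*-zeroʳ e₁))) ⟩
        0ℚ + ½                   ≡⟨ ℚP.+-identityˡ ½ ⟩
        ½                        ∎
      where
      open ≡-Reasoning
      gap : coeff (dickson m δ) (3 ℕ.+ E) ≡ 0ℚ
      gap = dickson-gap m δ 1 (3 ℕ.+ E) (pos 3) refl (λ i → ℕP.even≢odd i 0)
      scale≢0 : K * γ ^ℚ (3 ℕ.+ E) * binomℚ 1 N ≢ 0ℚ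
      scale≢0 = *-≢0 (*-≢0 K≢0 (^ℚ-≢0 (3 ℕ.+ E) γ≢0))
                     (λ eq → shifted≢0 3 (trans (solve 1 (λ N → N := binomS 1 N) refl N) eq))

    x₀ x₂ x₄ : ℚ
    x₀ = K * γ ^ℚ (4 ℕ.+ E) * binomℚ 0 N * bernoulliAt 0 ½
    x₂ = K * γ ^ℚ (2 ℕ.+ E) * binomℚ 2 N * bernoulliAt 2 ½
    x₄ = K * γ ^ℚ (0 ℕ.+ E) * binomℚ 4 N * bernoulliAt 4 ½

    at½ : ∀ l c → l ℕ.+ c ≡ 4 → ∀ v → coeff (dickson m δ) (c ℕ.+ E) ≡ v →
          K * γ ^ℚ (c ℕ.+ E) * binomℚ l N * bernoulliAt l ½ ≡ e₁ * v
    at½ l c eq v dv = trans (cong (λ z → K * γ ^ℚ (c ℕ.+ E) * binomℚ l N * bernoulliAt l z) (sym s≡½)) (compare l c eq v dv)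

    x₀≡ : x₀ ≡ e₁ * 1ℚ
    x₀≡ = at½ 0 4 refl 1ℚ (trans (dickson-coeff m δ 0 m 0 (pos 4) refl refl) (κ-0 (3 ℕ.+ E) δ))

    r₂ r₄ : ℚ
    r₂ = N * (- δ * 1ℚ)
    r₄ = ½ * (N * (ℕ→ℚ 1 + ν)) * (- δ * (- δ * 1ℚ))

    x₂≡ : x₂ ≡ e₁ * r₂
    x₂≡ = at½ 2 2 refl r₂ (trans (dickson-coeff m δ 2 (2 ℕ.+ E) 1 (pos 2) refl refl) κ-1)
    x₄≡ : x₄ ≡ e₁ * r₄
    x₄≡ = at½ 4 0 refl r₄ (trans (dickson-coeff m δ 4 E 2 (pos 0) refl refl) κ-2)

    relation-right : dicksonRelation x₂ x₄ x₀ ≡ 0ℚ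
    relation-right = begin
        dicksonRelation x₂ x₄ x₀                        ≡⟨ cong₂ (λ u w → dicksonRelation u w x₀) x₂≡ x₄≡ ⟩
        dicksonRelation (e₁ * r₂) (e₁ * r₄) x₀          ≡⟨ cong (dicksonRelation (e₁ * r₂) (e₁ * r₄)) x₀≡ ⟩
        dicksonRelation (e₁ * r₂) (e₁ * r₄) (e₁ * 1ℚ)   ≡⟨ solve 3 (λ e ν δ →
            let N = con (ℕ→ℚ 4) :+ ν
                x₂ = e :* (N :* (:- δ :* con 1ℚ))
                x₄ = e :* (con ½ :* (N :* (con (ℕ→ℚ 1) :+ ν)) :* (:- δ :* (:- δ :* con 1ℚ)))
            in x₂ :* x₂ :* (con (ℕ→ℚ 1) :+ ν) :- con (ℕ→ℚ 2) :* N :* x₄ :* (e :* con 1ℚ) := con 0ℚ) refl e₁ ν δ ⟩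
        0ℚ                                              ∎
      where open ≡-Reasoning

    Q : ℚ
    Q = K * K * γ ^ℚ 4 * (γ ^ℚ E * γ ^ℚ E) * (N * N) * (ℕ→ℚ 3 + ν) * (ℕ→ℚ 1 + ν)

    relation-left : dicksonRelation x₂ x₄ x₀ ≡ Q * (ℤ.+ 1 / 2880) * (1ℚ ℚ.- ℕ→ℚ 2 * ν)
    relation-left = solve 4 (λ K γ Y ν →
        let N = con (ℕ→ℚ 4) :+ ν
            x₀ = K :* (γ :* (γ :* (γ :* (γ :* Y)))) :* binomS 0 N :* con (bernoulliAt 0 ½)
            x₂ = K :* (γ :* (γ :* Y)) :* binomS 2 N :* con (bernoulliAt 2 ½)
            x₄ = K :* Y :* binomS 4 N :* con (bernoulliAt 4 ½)
        in x₂ :* x₂ :* (con (ℕ→ℚ 1) :+ ν) :- con (ℕ→ℚ 2) :* N :* x₄ :* x₀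
           := K :* K :* powS γ 4 :* (Y :* Y) :* (N :* N) :* (con (ℕ→ℚ 3) :+ ν) :* (con (ℕ→ℚ 1) :+ ν)
              :* con (ℤ.+ 1 / 2880) :* (con 1ℚ :- con (ℕ→ℚ 2) :* ν)) refl K γ (γ ^ℚ E) ν

    Q≢0 : Q ≢ 0ℚ
    Q≢0 = *-≢0 (*-≢0 (*-≢0 (*-≢0 (*-≢0 (*-≢0 K≢0 K≢0) (^ℚ-≢0 4 γ≢0)) (*-≢0 Y≢0 Y≢0)) (*-≢0 (shifted≢0 3) (shifted≢0 3)))
               (shifted≢0 2)) (shifted≢0 0)
      where Y≢0 : γ ^ℚ E ≢ 0ℚ
            Y≢0 = ^ℚ-≢0 E γ≢0

    impossible : ⊥
    impossible = *-≢0 (*-≢0 Q≢0 (λ ())) 1-2ν≢0 (trans (sym relation-left) relation-right)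

module LeftSide (a b : ℤ) (k : ℕ) (c₁ c₀ : ℚ) where
  n : ℕ
  n = suc k

  A r : ℚ
  A = ℤ→ℚ (a ℤ.^ k) * (ℤ.+ 1 / suc k)
  r = divℤ b a

  module Shift = Affine (0ℚ + r) 1ℚ
  module Outer = Affine (c₁ * 0ℚ + c₀) (c₁ * 1ℚ)

  T : Poly
  T = S a b k ∘ₚ (c₁ ·ₚ Xₚ +ₚ constₚ c₀)

  A≢0 : a ≢ 0ℤ → A ≢ 0ℚ
  A≢0 a≢0 = *-≢0 (λ eq → a≢0 (ℤP.i^n≡0⇒i≡0 a k (ℤ→ℚ-injective eq)))
    (λ eq → ℕ→ℚ-suc≢0 0 (trans (sym (/-*-cancel (ℤ.+ 1) (suc k))) (trans (cong (_* ℕ→ℚ (suc k)) eq) (ℚP.*-zeroˡ (ℕ→ℚ (suc k))))))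

  S-coeff : ∀ t → 0 < t → coeff (S a b k) t ≡ A * coeff (bernoulliPoly n ∘ₚ Shift.affine) t
  S-coeff t 0<t = trans (coeff-· A (bernoulliPoly n ∘ₚ Shift.affine +ₚ constₚ c) t)
                         (cong (A *_) (coeff-+const (bernoulliPoly n ∘ₚ Shift.affine) c t 0<t))
    where c : ℚ
          c = - evalₚ (bernoulliPoly n) r

  S-deg : ∀ t → n < t → coeff (S a b k) t ≡ 0ℚ
  S-deg t n<t = trans (S-coeff t (ℕP.<-trans (s≤s z≤n) n<t))
    (trans (cong (A *_) (Shift.∘affine-deg (bernoulliPoly n) n (bernoulliPoly-deg n) t n<t)) (ℚP.*-zeroʳ A))

  T-deg : ∀ t → n < t → coeff T t ≡ 0ℚ
  T-deg = Outer.∘affine-deg (S a b k) n S-deg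

  T-lead : coeff T n ≡ A * (1ℚ * 1ℚ ^ℚ n) * (c₁ * 1ℚ) ^ℚ n
  T-lead = begin
      coeff T n                                          ≡⟨ Outer.coeff-∘affine-lead (S a b k) n S-deg ⟩
      coeff (S a b k) n * (c₁ * 1ℚ) ^ℚ n                 ≡⟨ cong (_* (c₁ * 1ℚ) ^ℚ n) (S-coeff n (s≤s z≤n)) ⟩
      A * coeff (bernoulliPoly n ∘ₚ Shift.affine) n * (c₁ * 1ℚ) ^ℚ n
        ≡⟨ cong (λ z → A * z * (c₁ * 1ℚ) ^ℚ n) (Shift.coeff-∘affine-lead (bernoulliPoly n) n (bernoulliPoly-deg n)) ⟩
      A * (coeff (bernoulliPoly n) n * 1ℚ ^ℚ n) * (c₁ * 1ℚ) ^ℚ n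
        ≡⟨ cong (λ z → A * (z * 1ℚ ^ℚ n) * (c₁ * 1ℚ) ^ℚ n) (bernoulliPoly-coeff 0 n) ⟩
      A * (1ℚ * 1ℚ ^ℚ n) * (c₁ * 1ℚ) ^ℚ n                ∎
    where open ≡-Reasoning

  T-lead≢0 : a ≢ 0ℤ → c₁ ≢ 0ℚ → coeff T n ≢ 0ℚ
  T-lead≢0 a≢0 c₁≢0 eq = *-≢0 (*-≢0 (A≢0 a≢0) (*-≢0 1≢0 (^ℚ-≢0 n 1≢0)))
                               (^ℚ-≢0 n (*-≢0 c₁≢0 1≢0)) (trans (sym T-lead) eq)

-- n < m: the coefficient of x^m is 0 on the left and e₁ on the right.
lower-degree : ∀ a b k c₁ c₀ e₁ e₀ m δ → e₁ ≢ 0ℚ → suc k < m →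
               ¬ (S a b k ∘ₚ (c₁ ·ₚ Xₚ +ₚ constₚ c₀) ≈ₚ e₁ ·ₚ dickson m δ +ₚ constₚ e₀)
lower-degree a b k c₁ c₀ e₁ e₀ (suc m) δ e₁≢0 n<m T≈R = e₁≢0 (begin
    e₁                                                      ≡⟨ sym (ℚP.*-identityʳ e₁) ⟩
    e₁ * 1ℚ                                                 ≡⟨ cong (e₁ *_) (sym (trans (dickson-coeff (suc m) δ 0 (suc m) 0 (s≤s z≤n) refl refl) (κ-0 m δ))) ⟩
    e₁ * coeff (dickson (suc m) δ) (suc m)                  ≡⟨ sym (coeff-rhs e₁ e₀ (dickson (suc m) δ) (suc m) (s≤s z≤n)) ⟩
    coeff (e₁ ·ₚ dickson (suc m) δ +ₚ constₚ e₀) (suc m)    ≡⟨ sym (T≈R (suc m)) ⟩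
    coeff T (suc m)                                         ≡⟨ T-deg (suc m) n<m ⟩
    0ℚ                                                      ∎)
  where open ≡-Reasoning
        open LeftSide a b k c₁ c₀

-- m < n: the coefficient of x^n is A c₁ⁿ ≠ 0 on the left and 0 on the right.
higher-degree : ∀ a b k c₁ c₀ e₁ e₀ m δ → a ≢ 0ℤ → c₁ ≢ 0ℚ → m < suc k →
                ¬ (S a b k ∘ₚ (c₁ ·ₚ Xₚ +ₚ constₚ c₀) ≈ₚ e₁ ·ₚ dickson m δ +ₚ constₚ e₀)
higher-degree a b k c₁ c₀ e₁ e₀ m δ a≢0 c₁≢0 m<n T≈R = T-lead≢0 a≢0 c₁≢0 (begin
    coeff T n                                          ≡⟨ T≈R n ⟩
    coeff (e₁ ·ₚ dickson m δ +ₚ constₚ e₀) n           ≡⟨ coeff-rhs e₁ e₀ (dickson m δ) n (s≤s z≤n) ⟩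
    e₁ * coeff (dickson m δ) n                         ≡⟨ cong (e₁ *_) (dickson-deg m δ n m<n) ⟩
    e₁ * 0ℚ                                            ≡⟨ ℚP.*-zeroʳ e₁ ⟩
    0ℚ                                                 ∎)
  where open ≡-Reasoning
        open LeftSide a b k c₁ c₀

-- n = m > 4: T has Bernoulli top (A, c₁, r + c₀) up to trivial factors,
-- which EqualDegree rules out.
equal-degree : ∀ a b k c₁ c₀ e₁ e₀ δ → a ≢ 0ℤ → c₁ ≢ 0ℚ → e₁ ≢ 0ℚ → 4 < suc k →
               ¬ (S a b k ∘ₚ (c₁ ·ₚ Xₚ +ₚ constₚ c₀) ≈ₚ e₁ ·ₚ dickson (suc k) δ +ₚ constₚ e₀)
equal-degree a b .(4 ℕ.+ p) c₁ c₀ e₁ e₀ δ a≢0 c₁≢0 e₁≢0 (s≤s (s≤s (s≤s (s≤s (s≤s {n = p} z≤n))))) T≈R =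
  EqualDegree.impossible p (*-≢0 (A≢0 a≢0) 1≢0) (*-≢0 (*-≢0 c₁≢0 1≢0) (*-≢0 1≢0 1≢0)) shape e₁≢0 T≈R
  where
  open LeftSide a b (4 ℕ.+ p) c₁ c₀
  open BernoulliTop (suc p)
  shape : HasBernoulliTop T (A * 1ℚ) (c₁ * 1ℚ * (1ℚ * 1ℚ)) (0ℚ + 1ℚ * (0ℚ + r) + 1ℚ * 1ℚ * (c₁ * 0ℚ + c₀))
  shape = compose (c₁ * 0ℚ + c₀) (c₁ * 1ℚ) (scale-shift A _ (s≤s z≤n) (compose (0ℚ + r) 1ℚ bernoulliPoly-top))

lemma4 : (a b : ℤ) → a ≢ 0ℤ → gcd a b ≡ 1ℤ →
         (k : ℕ) → 1 ≤ k →
         (c₁ c₀ e₁ e₀ : ℚ) → c₁ ≢ 0ℚ → e₁ ≢ 0ℚ →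
         (m : ℕ) → 4 < m →
         (δ : ℚ) → δ ≢ 0ℚ →
         ¬ (S a b k ∘ₚ (c₁ ·ₚ Xₚ +ₚ constₚ c₀) ≈ₚ e₁ ·ₚ dickson m δ +ₚ constₚ e₀)
lemma4 a b a≢0 _ k _ c₁ c₀ e₁ e₀ c₁≢0 e₁≢0 m 4<m δ _ with ℕP.<-cmp (suc k) m
... | tri< n<m _ _  = lower-degree a b k c₁ c₀ e₁ e₀ m δ e₁≢0 n<m
... | tri≈ _ refl _ = equal-degree a b k c₁ c₀ e₁ e₀ δ a≢0 c₁≢0 e₁≢0 4<m
... | tri> _ _ m<n  = higher-degree a b k c₁ c₀ e₁ e₀ m δ a≢0 c₁≢0 m<n
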